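{- Let $G$ be a bipartite graph with $\eta(G)=1$ on $n$ vertices, with partite vertex sets $V_1$ and $V_2$. Then (i) $n$ is odd; (ii) if $|V_1|>|V_2|$, then $|V_2|=\frac{n-1}{2}$ and $|V_1|=|V_2|+1$; (iii) if $|V_1|>|V_2|$, then $CV\subseteq V_1$, where $CV$ is the set of core vertices of $G$.
   Context: $\eta(G)=\dim\ker\mathbf{A}$ for the $\{0,1\}$-adjacency matrix $\mathbf{A}$ of $G$. A vertex $v$ is a core vertex if some $\mathbf{x}\in\ker\mathbf{A}$ has $x_v\neq0$.
   Formalization: The kernel of the adjacency matrix $\mathbf{A}$, which defines both $\eta(G)$ and the core vertices, is taken over the rationals. -}

module Defs where

open import Data.Nat using (ℕ; zero; suc)
import Data.Nat
import Data.Rational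
open import Data.Fin using (Fin; zero; suc)
open import Data.Bool using (Bool; true; false; if_then_else_)
open import Data.Rational using (ℚ; 0ℚ; _+_; _*_)
open import Data.Product using (Σ; ∃; _×_; _,_)
open import Relation.Binary.PropositionalEquality using (_≡_; _≢_)

record Graph (n : ℕ) : Set where
  field
    adj      : Fin n → Fin n → Bool
    adj-sym  : ∀ i j → adj i j ≡ adj j i
    adj-irr  : ∀ i → adj i i ≡ false
open Graph public

Σᶠ : (n : ℕ) → (Fin n → ℚ) → ℚ
Σᶠ zero    f = 0ℚ
Σᶠ (suc n) f = f zero + Σᶠ n (λ i → f (suc i))

A : ∀ {n} → Graph n → Fin n → Fin n → ℚ
A G i j = if adj G i j then Data.Rational.1ℚ else 0ℚ

mulA : ∀ {n} → Graph n → (Fin n → ℚ) → Fin n → ℚ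
mulA {n} G x i = Σᶠ n (λ j → A G i j * x j)

InKer : ∀ {n} → Graph n → (Fin n → ℚ) → Set
InKer G x = ∀ i → mulA G x i ≡ 0ℚ

-- η(G) = dim ker A = 1: the kernel has a basis consisting of one vector,
-- i.e. there is a nonzero kernel vector b and every kernel vector is a
-- scalar multiple of b.
NullityOne : ∀ {n} → Graph n → Set
NullityOne {n} G =
  Σ (Fin n → ℚ) λ b →
    InKer G b × (Σ (Fin n) λ v → b v ≢ 0ℚ) ×
    (∀ x → InKer G x → Σ ℚ λ c → ∀ i → x i ≡ c * b i)

Core : ∀ {n} → Graph n → Fin n → Set
Core {n} G v = Σ (Fin n → ℚ) λ x → InKer G x × x v ≢ 0ℚ

-- A bipartition given by side : Fin n → Bool
-- (V₁ = {v | side v ≡ true}, V₂ = {v | side v ≡ false}); every edge crosses it.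
IsBipartition : ∀ {n} → Graph n → (Fin n → Bool) → Set
IsBipartition G side = ∀ i j → adj G i j ≡ true → side i ≢ side j

count : (n : ℕ) → (Fin n → Bool) → Bool → ℕ
count zero    s b = 0
count (suc n) s b = (if s zero ≟ᵇ b then 1 else 0) Data.Nat.+ count n (λ i → s (suc i)) b
  where
  _≟ᵇ_ : Bool → Bool → Bool
  true  ≟ᵇ true  = true
  false ≟ᵇ false = true
  _     ≟ᵇ _     = false

-- Write V₁, V₂ for the two sides and let b span ker A. A homogeneous system with fewer
-- equations than unknowns has a nonzero solution (Gaussian elimination). If |V₂| < |V₁|,
-- imposing the rows of V₂ on vectors supported on V₁ therefore yields a kernel vector
-- supported on V₁, and if even |V₂| + 1 < |V₁| one vanishing at a vertex v with b v ≠ 0.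
-- As the restriction of a kernel vector to one side is again a kernel vector, η = 1 rules
-- out both a core vertex in V₂ and |V₂| + 1 < |V₁|. If |V₁| = |V₂|, say b v ≠ 0 with
-- v ∈ V₁, imposing the rows of V₁ ∖ {v} on vectors supported on V₂ gives w ≠ 0 with w v = 0,
-- and symmetry of A makes w a kernel vector; so the sides differ by exactly one.

module Submission where

open import Defs
open import Data.Nat using (ℕ; suc; _+_; _*_; _∸_; _/_; _>_)
open import Data.Fin using (Fin)
open import Data.Bool using (Bool; true; false)
open import Data.Product using (Σ; _×_)
open import Relation.Binary.PropositionalEquality using (_≡_)

open import Data.Nat using (zero; _≤_; _<_; z≤n; s≤s)
import Data.Nat.Properties as ℕₚ
open import Data.Nat.DivMod using (m*n/n≡m)
open import Data.Fin using (zero; suc; _≟_)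
open import Data.Fin.Properties using (any?; suc-injective)
open import Data.Bool using (not; if_then_else_)
open import Data.Bool.Properties using (not-involutive; not-injective)
open import Data.Product using (_,_; proj₁; proj₂; map₂)
open import Data.Sum using (_⊎_; inj₁; inj₂)
open import Data.Empty using (⊥; ⊥-elim)
open import Function using (_∘_)
open import Relation.Nullary using (¬_; yes; no; does)
open import Relation.Nullary.Decidable using (¬?; _×-dec_; dec-true; dec-false)
open import Relation.Binary.PropositionalEquality
  using (_≢_; refl; sym; trans; cong; cong₂; subst; subst₂; module ≡-Reasoning)
open import Relation.Binary.Definitions using (tri<; tri≈; tri>)
open import Data.Rational as ℚ using (ℚ; 0ℚ; 1ℚ; 1/_; NonZero; ≢-nonZero)
import Data.Rational.Properties as ℚₚ
open import Data.Rational.Solver using (module +-*-Solver)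
open +-*-Solver using (solve; _:+_; _:*_; :-_; _:-_; _:=_; con)

Σᶠ-cong : ∀ n {f g : Fin n → ℚ} → (∀ i → f i ≡ g i) → Σᶠ n f ≡ Σᶠ n g
Σᶠ-cong zero    f≡g = refl
Σᶠ-cong (suc n) f≡g = cong₂ ℚ._+_ (f≡g zero) (Σᶠ-cong n (f≡g ∘ suc))

Σᶠ-zero : ∀ n {f : Fin n → ℚ} → (∀ i → f i ≡ 0ℚ) → Σᶠ n f ≡ 0ℚ
Σᶠ-zero zero    f≡0 = refl
Σᶠ-zero (suc n) f≡0 = cong₂ ℚ._+_ (f≡0 zero) (Σᶠ-zero n (f≡0 ∘ suc))

Σᶠ-+ : ∀ n (f g : Fin n → ℚ) → Σᶠ n (λ i → f i ℚ.+ g i) ≡ Σᶠ n f ℚ.+ Σᶠ n g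
Σᶠ-+ zero    f g = refl
Σᶠ-+ (suc n) f g = begin
  (f zero ℚ.+ g zero) ℚ.+ Σᶠ n (λ i → f (suc i) ℚ.+ g (suc i))
    ≡⟨ cong ((f zero ℚ.+ g zero) ℚ.+_) (Σᶠ-+ n (f ∘ suc) (g ∘ suc)) ⟩
  (f zero ℚ.+ g zero) ℚ.+ (Σᶠ n (f ∘ suc) ℚ.+ Σᶠ n (g ∘ suc))
    ≡⟨ solve 4 (λ a b c d → (a :+ b) :+ (c :+ d) := (a :+ c) :+ (b :+ d)) refl
         (f zero) (g zero) (Σᶠ n (f ∘ suc)) (Σᶠ n (g ∘ suc)) ⟩
  (f zero ℚ.+ Σᶠ n (f ∘ suc)) ℚ.+ (g zero ℚ.+ Σᶠ n (g ∘ suc)) ∎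
  where open ≡-Reasoning

Σᶠ-*ˡ : ∀ n c (f : Fin n → ℚ) → Σᶠ n (λ i → c ℚ.* f i) ≡ c ℚ.* Σᶠ n f
Σᶠ-*ˡ zero    c f = sym (ℚₚ.*-zeroʳ c)
Σᶠ-*ˡ (suc n) c f =
  trans (cong (c ℚ.* f zero ℚ.+_) (Σᶠ-*ˡ n c (f ∘ suc))) (sym (ℚₚ.*-distribˡ-+ c (f zero) _))

Σᶠ-comm : ∀ m n (f : Fin m → Fin n → ℚ) →
          Σᶠ m (λ i → Σᶠ n (f i)) ≡ Σᶠ n (λ j → Σᶠ m (λ i → f i j))
Σᶠ-comm zero    n f = sym (Σᶠ-zero n (λ _ → refl))
Σᶠ-comm (suc m) n f =
  trans (cong (Σᶠ n (f zero) ℚ.+_) (Σᶠ-comm m n (f ∘ suc)))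
        (sym (Σᶠ-+ n (f zero) (λ j → Σᶠ m (λ i → f (suc i) j))))

Σᶠ-single : ∀ n (f : Fin n → ℚ) v → (∀ i → i ≢ v → f i ≡ 0ℚ) → Σᶠ n f ≡ f v
Σᶠ-single (suc n) f zero    f≡0 =
  trans (cong (f zero ℚ.+_) (Σᶠ-zero n (λ i → f≡0 (suc i) λ ()))) (ℚₚ.+-identityʳ (f zero))
Σᶠ-single (suc n) f (suc v) f≡0 =
  trans (cong₂ ℚ._+_ (f≡0 zero λ ()) (Σᶠ-single n (f ∘ suc) v (λ i i≢v → f≡0 (suc i) (i≢v ∘ suc-injective))))
        (ℚₚ.+-identityˡ (f (suc v)))

-- Subsets of Fin n as Boolean predicates

size : ∀ {n} → (Fin n → Bool) → ℕ
size {n} S = count n S true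

remove : ∀ {n} → (Fin n → Bool) → Fin n → Fin n → Bool
remove S v i = if does (i ≟ v) then false else S i

remove-self : ∀ {n} (S : Fin n → Bool) v → remove S v v ≡ false
remove-self S v rewrite dec-true (v ≟ v) refl = refl

remove-other : ∀ {n} (S : Fin n → Bool) {v i} → i ≢ v → remove S v i ≡ S i
remove-other S {v} {i} i≢v rewrite dec-false (i ≟ v) i≢v = refl

remove-false : ∀ {n} (S : Fin n → Bool) v {i} → S i ≡ false → remove S v i ≡ false
remove-false S v {i} Si≡false with does (i ≟ v)
... | true  = refl
... | false = Si≡false

size-cong : ∀ {n} {S T : Fin n → Bool} → (∀ i → S i ≡ T i) → size S ≡ size T
size-cong {zero}          S≡T = refl
size-cong {suc n} {S} {T} S≡T with S zero | T zero | S≡T zero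
... | true  | true  | refl = cong suc (size-cong (S≡T ∘ suc))
... | false | false | refl = size-cong (S≡T ∘ suc)

size-remove : ∀ {n} (S : Fin n → Bool) {v} → S v ≡ true → size S ≡ suc (size (remove S v))
size-remove {suc n} S {zero}  Sv≡true rewrite Sv≡true = refl
size-remove {suc n} S {suc v} Sv≡true with S zero
... | true  = cong suc (size-remove (S ∘ suc) Sv≡true)
... | false = size-remove (S ∘ suc) Sv≡true

size≤size-remove+1 : ∀ {n} (S : Fin n → Bool) v → size S ≤ suc (size (remove S v))
size≤size-remove+1 S v with S v in Sv
... | true  = ℕₚ.≤-reflexive (size-remove S Sv)
... | false = ℕₚ.≤-trans (ℕₚ.≤-reflexive (size-cong S≡remove)) (ℕₚ.n≤1+n _)
  where
  S≡remove : ∀ i → S i ≡ remove S v i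
  S≡remove i with i ≟ v
  ... | yes refl = Sv
  ... | no  _    = refl

size>0⇒nonempty : ∀ {n} (S : Fin n → Bool) → 0 < size S → Σ (Fin n) λ i → S i ≡ true
size>0⇒nonempty {suc n} S 0<∣S∣ with S zero in S0
... | true  = zero , S0
... | false = let i , Si = size>0⇒nonempty (S ∘ suc) 0<∣S∣ in suc i , Si

nonempty⇒size>0 : ∀ {n} (S : Fin n → Bool) {v} → S v ≡ true → 0 < size S
nonempty⇒size>0 S Sv = subst (0 <_) (sym (size-remove S Sv)) (s≤s z≤n)

count-false≡size-not : ∀ n (S : Fin n → Bool) → count n S false ≡ size (not ∘ S)
count-false≡size-not zero    S = refl
count-false≡size-not (suc n) S with S zero
... | true  = count-false≡size-not n (S ∘ suc)
... | false = cong suc (count-false≡size-not n (S ∘ suc))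

size+size-not : ∀ n (S : Fin n → Bool) → size S + size (not ∘ S) ≡ n
size+size-not zero    S = refl
size+size-not (suc n) S with S zero
... | true  = cong suc (size+size-not n (S ∘ suc))
... | false = trans (ℕₚ.+-suc _ _) (cong suc (size+size-not n (S ∘ suc)))

size-not-not : ∀ {n} (S : Fin n → Bool) → size (not ∘ not ∘ S) ≡ size S
size-not-not S = size-cong (not-involutive ∘ S)

≢-by-membership : ∀ {n} (S : Fin n → Bool) {i j} → S i ≡ false → S j ≡ true → i ≢ j
≢-by-membership S Si Sj refl with trans (sym Si) Sj
... | ()

-- Homogeneous linear systems over ℚ

_·_ : ∀ {m n} → (Fin m → Fin n → ℚ) → (Fin n → ℚ) → Fin m → ℚ
_·_ {n = n} M x i = Σᶠ n (λ l → M i l ℚ.* x l)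

Supported : ∀ {n} → (Fin n → ℚ) → (Fin n → Bool) → Set
Supported x U = ∀ l → U l ≡ false → x l ≡ 0ℚ

Nonzero : ∀ {n} → (Fin n → ℚ) → Set
Nonzero {n} x = Σ (Fin n) λ l → x l ≢ 0ℚ

record NontrivialSolution {m n} (M : Fin m → Fin n → ℚ) (E : Fin m → Bool) (U : Fin n → Bool) : Set where
  field
    x         : Fin n → ℚ
    supported : Supported x U
    nonzero   : Nonzero x
    solves    : ∀ i → E i ≡ true → (M · x) i ≡ 0ℚ

single : ∀ {n} → Fin n → ℚ → Fin n → ℚ
single l c j = if does (j ≟ l) then c else 0ℚ

single-on : ∀ {n} (l : Fin n) c → single l c l ≡ c
single-on l c rewrite dec-true (l ≟ l) refl = refl

single-off : ∀ {n} {l j : Fin n} c → j ≢ l → single l c j ≡ 0ℚ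
single-off {l = l} {j} c j≢l rewrite dec-false (j ≟ l) j≢l = refl

·-single : ∀ {m n} (M : Fin m → Fin n → ℚ) l c i → (M · single l c) i ≡ M i l ℚ.* c
·-single {n = n} M l c i =
  trans (Σᶠ-single n _ l (λ j j≢l → trans (cong (M i j ℚ.*_) (single-off c j≢l)) (ℚₚ.*-zeroʳ (M i j))))
        (cong (M i l ℚ.*_) (single-on l c))

·-+ : ∀ {m n} (M : Fin m → Fin n → ℚ) x y i → (M · (λ l → x l ℚ.+ y l)) i ≡ (M · x) i ℚ.+ (M · y) i
·-+ {n = n} M x y i = trans (Σᶠ-cong n (λ l → ℚₚ.*-distribˡ-+ (M i l) (x l) (y l))) (Σᶠ-+ n _ _)

·-vanishing-row : ∀ {m n} (M : Fin m → Fin n → ℚ) {x U} i → Supported x U →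
                  (∀ l → U l ≡ true → M i l ≡ 0ℚ) → (M · x) i ≡ 0ℚ
·-vanishing-row {n = n} M {x} {U} i x∈U row≡0 = Σᶠ-zero n term≡0
  where
  term≡0 : ∀ l → M i l ℚ.* x l ≡ 0ℚ
  term≡0 l with U l in Ul
  ... | true  = trans (cong (ℚ._* x l) (row≡0 l Ul)) (ℚₚ.*-zeroˡ (x l))
  ... | false = trans (cong (M i l ℚ.*_) (x∈U l Ul)) (ℚₚ.*-zeroʳ (M i l))

no-equations : ∀ {m n} (M : Fin m → Fin n → ℚ) (E : Fin m → Bool) (U : Fin n → Bool) →
               size E ≡ 0 → 0 < size U → NontrivialSolution M E U
no-equations M E U ∣E∣≡0 0<∣U∣ = record
  { x         = single l 1ℚ
  ; supported = λ j Uj → single-off 1ℚ (≢-by-membership U Uj Ul)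
  ; nonzero   = l , λ x≡0 → ℚₚ.1≢0 (trans (sym (single-on l 1ℚ)) x≡0)
  ; solves    = λ i Ei → ⊥-elim (ℕₚ.<-irrefl (sym ∣E∣≡0) (nonempty⇒size>0 E Ei))
  }
  where
  l  = proj₁ (size>0⇒nonempty U 0<∣U∣)
  Ul = proj₂ (size>0⇒nonempty U 0<∣U∣)

drop-vanishing-row : ∀ {m n} {M : Fin m → Fin n → ℚ} {E U} i₀ → (∀ l → U l ≡ true → M i₀ l ≡ 0ℚ) →
                     NontrivialSolution M (remove E i₀) U → NontrivialSolution M E U
drop-vanishing-row {M = M} {E} {U} i₀ row≡0 s = record
  { x = S.x ; supported = S.supported ; nonzero = S.nonzero ; solves = solves }
  where
  module S = NontrivialSolution s
  solves : ∀ i → E i ≡ true → (M · S.x) i ≡ 0ℚ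
  solves i Ei with i ≟ i₀
  ... | yes refl = ·-vanishing-row M i₀ S.supported row≡0
  ... | no  i≢i₀ = S.solves i (trans (remove-other E i≢i₀) Ei)

module Elimination {m n} (M : Fin m → Fin n → ℚ) (i₀ : Fin m) (l₀ : Fin n)
                   .{{_ : NonZero (M i₀ l₀)}} where

  factor : Fin m → ℚ
  factor i = M i l₀ ℚ.* 1/ M i₀ l₀

  eliminate : Fin m → Fin n → ℚ
  eliminate i l = M i l ℚ.- factor i ℚ.* M i₀ l

  eliminate-· : ∀ y i → (eliminate · y) i ≡ (M · y) i ℚ.- factor i ℚ.* (M · y) i₀
  eliminate-· y i = begin
    (eliminate · y) i
      ≡⟨ Σᶠ-cong n (λ l → solve 4 (λ a f b z → (a :- f :* b) :* z := a :* z :+ (:- f) :* (b :* z))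
                                  refl (M i l) (factor i) (M i₀ l) (y l)) ⟩
    Σᶠ n (λ l → M i l ℚ.* y l ℚ.+ ℚ.- factor i ℚ.* (M i₀ l ℚ.* y l))
      ≡⟨ Σᶠ-+ n _ _ ⟩
    (M · y) i ℚ.+ Σᶠ n (λ l → ℚ.- factor i ℚ.* (M i₀ l ℚ.* y l))
      ≡⟨ cong ((M · y) i ℚ.+_) (Σᶠ-*ˡ n (ℚ.- factor i) _) ⟩
    (M · y) i ℚ.+ ℚ.- factor i ℚ.* (M · y) i₀
      ≡⟨ solve 3 (λ s f t → s :+ (:- f) :* t := s :- f :* t) refl ((M · y) i) (factor i) ((M · y) i₀) ⟩
    (M · y) i ℚ.- factor i ℚ.* (M · y) i₀ ∎
    where open ≡-Reasoning

  eliminate-·-pivot-row : ∀ y → (eliminate · y) i₀ ≡ 0ℚ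
  eliminate-·-pivot-row y = begin
    (eliminate · y) i₀                           ≡⟨ eliminate-· y i₀ ⟩
    (M · y) i₀ ℚ.- factor i₀ ℚ.* (M · y) i₀       ≡⟨ cong (λ f → (M · y) i₀ ℚ.- f ℚ.* (M · y) i₀) (ℚₚ.*-inverseʳ (M i₀ l₀)) ⟩
    (M · y) i₀ ℚ.- 1ℚ ℚ.* (M · y) i₀             ≡⟨ solve 1 (λ s → s :- con 1ℚ :* s := con 0ℚ) refl ((M · y) i₀) ⟩
    0ℚ                                          ∎
    where open ≡-Reasoning

  back-substitute : (Fin n → ℚ) → Fin n → ℚ
  back-substitute y l = y l ℚ.+ single l₀ (ℚ.- (M · y) i₀ ℚ.* 1/ M i₀ l₀) l

  ·-back-substitute : ∀ y i → (M · back-substitute y) i ≡ (eliminate · y) i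
  ·-back-substitute y i = begin
    (M · back-substitute y) i
      ≡⟨ ·-+ M y (single l₀ c) i ⟩
    (M · y) i ℚ.+ (M · single l₀ c) i
      ≡⟨ cong ((M · y) i ℚ.+_) (·-single M l₀ c i) ⟩
    (M · y) i ℚ.+ M i l₀ ℚ.* c
      ≡⟨ solve 4 (λ s a t q → s :+ a :* ((:- t) :* q) := s :- (a :* q) :* t)
               refl ((M · y) i) (M i l₀) ((M · y) i₀) (1/ M i₀ l₀) ⟩
    (M · y) i ℚ.- factor i ℚ.* (M · y) i₀
      ≡⟨ sym (eliminate-· y i) ⟩
    (eliminate · y) i ∎
    where
    open ≡-Reasoning
    c = ℚ.- (M · y) i₀ ℚ.* 1/ M i₀ l₀

  lift-solution : ∀ {E U} → U l₀ ≡ true →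
                  NontrivialSolution eliminate (remove E i₀) (remove U l₀) → NontrivialSolution M E U
  lift-solution {E} {U} Ul₀ s = record
    { x = back-substitute S.x ; supported = supported ; nonzero = nonzero ; solves = solves }
    where
    module S = NontrivialSolution s
    supported : Supported (back-substitute S.x) U
    supported l Ul = cong₂ ℚ._+_ (S.supported l (trans (remove-other U l≢l₀) Ul)) (single-off _ l≢l₀)
      where l≢l₀ = ≢-by-membership U Ul Ul₀
    nonzero : Nonzero (back-substitute S.x)
    nonzero = let k , yk≢0 = S.nonzero in k , λ xk≡0 →
      let k≢l₀ = λ k≡l₀ → yk≢0 (trans (cong S.x k≡l₀) (S.supported l₀ (remove-self U l₀)))
      in yk≢0 (trans (sym (ℚₚ.+-identityʳ (S.x k))) (trans (cong (S.x k ℚ.+_) (sym (single-off _ k≢l₀))) xk≡0))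
    solves : ∀ i → E i ≡ true → (M · back-substitute S.x) i ≡ 0ℚ
    solves i Ei with i ≟ i₀
    ... | yes refl = trans (·-back-substitute S.x i₀) (eliminate-·-pivot-row S.x)
    ... | no  i≢i₀ = trans (·-back-substitute S.x i) (S.solves i (trans (remove-other E i≢i₀) Ei))

pivot-or-vanishing : ∀ {n} (U : Fin n → Bool) (r : Fin n → ℚ) →
                     (Σ (Fin n) λ l → U l ≡ true × r l ≢ 0ℚ) ⊎ (∀ l → U l ≡ true → r l ≡ 0ℚ)
pivot-or-vanishing U r with any? (λ l → (U l Data.Bool.≟ true) ×-dec ¬? (r l ℚ.≟ 0ℚ))
... | yes pivot  = inj₁ pivot
... | no  ¬pivot = inj₂ vanishing
  where
  vanishing : ∀ l → U l ≡ true → r l ≡ 0ℚ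
  vanishing l Ul with r l ℚ.≟ 0ℚ
  ... | yes rl≡0 = rl≡0
  ... | no  rl≢0 = ⊥-elim (¬pivot (l , Ul , rl≢0))

fewer-equations-than-unknowns : ∀ {m n} k (M : Fin m → Fin n → ℚ) (E : Fin m → Bool) (U : Fin n → Bool) →
                                size E ≡ k → size E < size U → NontrivialSolution M E U
fewer-equations-than-unknowns zero M E U ∣E∣≡0 ∣E∣<∣U∣ =
  no-equations M E U ∣E∣≡0 (ℕₚ.≤-trans (s≤s z≤n) ∣E∣<∣U∣)
fewer-equations-than-unknowns (suc k) M E U ∣E∣≡k+1 ∣E∣<∣U∣
  with size>0⇒nonempty E (subst (0 <_) (sym ∣E∣≡k+1) (s≤s z≤n))
... | i₀ , Ei₀ with pivot-or-vanishing U (M i₀) | ℕₚ.suc-injective (trans (sym (size-remove E Ei₀)) ∣E∣≡k+1)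
...   | inj₁ (l₀ , Ul₀ , p≢0) | ∣E-i₀∣≡k =
  Elimination.lift-solution M i₀ l₀ {{≢-nonZero p≢0}} Ul₀
    (fewer-equations-than-unknowns k _ (remove E i₀) (remove U l₀) ∣E-i₀∣≡k
      (ℕₚ.≤-pred (subst₂ _<_ (size-remove E Ei₀) (size-remove U Ul₀) ∣E∣<∣U∣)))
...   | inj₂ row≡0 | ∣E-i₀∣≡k =
  drop-vanishing-row i₀ row≡0
    (fewer-equations-than-unknowns k M (remove E i₀) U ∣E-i₀∣≡k
      (ℕₚ.<-trans (subst (size (remove E i₀) <_) (sym (size-remove E Ei₀)) (ℕₚ.n<1+n _)) ∣E∣<∣U∣))

symmetric-kernel-orthogonal : ∀ {n} (M : Fin n → Fin n → ℚ) {u} → (∀ i j → M i j ≡ M j i) →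
                              (∀ i → (M · u) i ≡ 0ℚ) → ∀ w → Σᶠ n (λ i → u i ℚ.* (M · w) i) ≡ 0ℚ
symmetric-kernel-orthogonal {n} M {u} M-sym Mu≡0 w = begin
  Σᶠ n (λ i → u i ℚ.* (M · w) i)
    ≡⟨ Σᶠ-cong n (λ i → sym (Σᶠ-*ˡ n (u i) (λ j → M i j ℚ.* w j))) ⟩
  Σᶠ n (λ i → Σᶠ n (λ j → u i ℚ.* (M i j ℚ.* w j)))
    ≡⟨ Σᶠ-comm n n _ ⟩
  Σᶠ n (λ j → Σᶠ n (λ i → u i ℚ.* (M i j ℚ.* w j)))
    ≡⟨ Σᶠ-cong n (λ j → Σᶠ-cong n (λ i → reassociate i j)) ⟩
  Σᶠ n (λ j → Σᶠ n (λ i → w j ℚ.* (M j i ℚ.* u i)))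
    ≡⟨ Σᶠ-cong n (λ j → trans (Σᶠ-*ˡ n (w j) _) (trans (cong (w j ℚ.*_) (Mu≡0 j)) (ℚₚ.*-zeroʳ (w j)))) ⟩
  Σᶠ n (λ _ → 0ℚ)
    ≡⟨ Σᶠ-zero n (λ _ → refl) ⟩
  0ℚ ∎
  where
  open ≡-Reasoning
  reassociate : ∀ i j → u i ℚ.* (M i j ℚ.* w j) ≡ w j ℚ.* (M j i ℚ.* u i)
  reassociate i j = trans (cong (λ a → u i ℚ.* (a ℚ.* w j)) (M-sym i j))
    (solve 3 (λ a b c → a :* (b :* c) := c :* (b :* a)) refl (u i) (M j i) (w j))

*-cancelˡ-zero : ∀ p q → p ≢ 0ℚ → p ℚ.* q ≡ 0ℚ → q ≡ 0ℚ
*-cancelˡ-zero p q p≢0 pq≡0 = begin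
  q                       ≡⟨ sym (ℚₚ.*-identityˡ q) ⟩
  1ℚ ℚ.* q                ≡⟨ cong (ℚ._* q) (sym (ℚₚ.*-inverseˡ p)) ⟩
  (1/ p ℚ.* p) ℚ.* q      ≡⟨ ℚₚ.*-assoc (1/ p) p q ⟩
  1/ p ℚ.* (p ℚ.* q)      ≡⟨ cong (1/ p ℚ.*_) pq≡0 ⟩
  1/ p ℚ.* 0ℚ             ≡⟨ ℚₚ.*-zeroʳ (1/ p) ⟩
  0ℚ                      ∎
  where
  open ≡-Reasoning
  instance _ = ≢-nonZero p≢0

-- Kernels of bipartite graphs

module _ {n : ℕ} (G : Graph n) where

  A-sym : ∀ i j → A G i j ≡ A G j i
  A-sym i j rewrite adj-sym G i j = refl

  IsBipartition-not : ∀ {side} → IsBipartition G side → IsBipartition G (not ∘ side)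
  IsBipartition-not bip i j ij∈G = bip i j ij∈G ∘ not-injective

  inKer-from-one-side : ∀ {side x} → IsBipartition G side → Supported x side →
                        (∀ i → side i ≡ false → mulA G x i ≡ 0ℚ) → InKer G x
  inKer-from-one-side {side} {x} bip x∈side equations i with side i in si
  ... | false = equations i si
  ... | true  = ·-vanishing-row (A G) i x∈side no-edge-inside
    where
    no-edge-inside : ∀ j → side j ≡ true → A G i j ≡ 0ℚ
    no-edge-inside j sj with adj G i j in ij∈G
    ... | false = refl
    ... | true  = ⊥-elim (bip i j ij∈G (trans si (sym sj)))

  restrict : (Fin n → Bool) → (Fin n → ℚ) → Fin n → ℚ
  restrict side x j = if side j then x j else 0ℚ

  restrict-supported : ∀ side x → Supported (restrict side x) side
  restrict-supported side x l sl rewrite sl = refl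

  restrict-inKer : ∀ {side x} → IsBipartition G side → InKer G x → InKer G (restrict side x)
  restrict-inKer {side} {x} bip Ax≡0 = inKer-from-one-side bip (restrict-supported side x) equations
    where
    equations : ∀ i → side i ≡ false → mulA G (restrict side x) i ≡ 0ℚ
    equations i si = trans (Σᶠ-cong n same-term) (Ax≡0 i)
      where
      same-term : ∀ j → A G i j ℚ.* restrict side x j ≡ A G i j ℚ.* x j
      same-term j with side j in sj
      ... | true  = refl
      ... | false with adj G i j in ij∈G
      ...   | false = trans (ℚₚ.*-zeroˡ 0ℚ) (sym (ℚₚ.*-zeroˡ (x j)))
      ...   | true  = ⊥-elim (bip i j ij∈G (trans si (sym sj)))

  nullityOne-separation : NullityOne G → ∀ {u w v} → InKer G u → InKer G w →
                          u v ≢ 0ℚ → w v ≡ 0ℚ → ¬ Nonzero w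
  nullityOne-separation (b , _ , _ , spans) {u} {w} {v} Au≡0 Aw≡0 uv≢0 wv≡0 (m , wm≢0)
    with spans u Au≡0 | spans w Aw≡0
  ... | c , u≡cb | d , w≡db = wm≢0 (trans (w≡db m) (trans (cong (ℚ._* b m) d≡0) (ℚₚ.*-zeroˡ (b m))))
    where
    bv≢0 : b v ≢ 0ℚ
    bv≢0 bv≡0 = uv≢0 (trans (u≡cb v) (trans (cong (c ℚ.*_) bv≡0) (ℚₚ.*-zeroʳ c)))
    d≡0 : d ≡ 0ℚ
    d≡0 = *-cancelˡ-zero (b v) d bv≢0 (trans (ℚₚ.*-comm (b v) d) (trans (sym (w≡db v)) wv≡0))

  kernel-vector-inside : ∀ {side U} → IsBipartition G side → (∀ l → side l ≡ false → U l ≡ false) →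
                         size (not ∘ side) < size U → Σ (Fin n → ℚ) λ w → InKer G w × Supported w U × Nonzero w
  kernel-vector-inside {side} {U} bip U⊆V₁ ∣V₂∣<∣U∣ =
    S.x , inKer-from-one-side bip (λ l sl → S.supported l (U⊆V₁ l sl)) (λ i si → S.solves i (cong not si)) ,
    S.supported , S.nonzero
    where module S = NontrivialSolution (fewer-equations-than-unknowns _ (A G) (not ∘ side) U refl ∣V₂∣<∣U∣)

  restrict-nonzero : ∀ side x {v} → side v ≡ true → x v ≢ 0ℚ → restrict side x v ≢ 0ℚ
  restrict-nonzero side x sv xv≢0 rewrite sv = xv≢0

  core-in-larger-side : ∀ {side} → IsBipartition G side → NullityOne G →
                        size (not ∘ side) < size side → ∀ v → Core G v → side v ≡ true
  core-in-larger-side {side} bip η≡1 ∣V₂∣<∣V₁∣ v (x , Ax≡0 , xv≢0) with side v in sv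
  ... | true  = refl
  ... | false with kernel-vector-inside bip (λ _ sl → sl) ∣V₂∣<∣V₁∣
  ...   | w , Aw≡0 , w∈V₁ , w≢0 =
    ⊥-elim (nullityOne-separation η≡1 (restrict-inKer (IsBipartition-not bip) Ax≡0) Aw≡0
              (restrict-nonzero (not ∘ side) x (cong not sv) xv≢0) (w∈V₁ v sv) w≢0)

  larger-side-exceeds-by-one : ∀ {side} → IsBipartition G side → NullityOne G →
                               size (not ∘ side) < size side → size side ≡ suc (size (not ∘ side))
  larger-side-exceeds-by-one {side} bip η≡1@(b , Ab≡0 , (v , bv≢0) , _) ∣V₂∣<∣V₁∣
    with size side ℕₚ.≤? suc (size (not ∘ side))
  ... | yes ∣V₁∣≤∣V₂∣+1 = ℕₚ.≤-antisym ∣V₁∣≤∣V₂∣+1 ∣V₂∣<∣V₁∣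
  ... | no  ∣V₁∣≰∣V₂∣+1 with kernel-vector-inside bip (λ _ → remove-false side v) ∣V₂∣<∣V₁-v∣
    where
    ∣V₂∣<∣V₁-v∣ : size (not ∘ side) < size (remove side v)
    ∣V₂∣<∣V₁-v∣ = ℕₚ.≤-pred (ℕₚ.≤-trans (ℕₚ.≰⇒> ∣V₁∣≰∣V₂∣+1) (size≤size-remove+1 side v))
  ...   | w , Aw≡0 , w∈V₁-v , w≢0 =
    ⊥-elim (nullityOne-separation η≡1 Ab≡0 Aw≡0 bv≢0 (w∈V₁-v v (remove-self side v)) w≢0)

  balanced-sides-impossible : ∀ {side u v} → IsBipartition G side → NullityOne G →
                              size side ≡ size (not ∘ side) →
                              InKer G u → Supported u side → u v ≢ 0ℚ → side v ≡ true → ⊥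
  balanced-sides-impossible {side} {u} {v} bip η≡1 ∣V₁∣≡∣V₂∣ Au≡0 u∈V₁ uv≢0 sv =
    nullityOne-separation η≡1 Au≡0 Aw≡0 uv≢0 (S.supported v (cong not sv)) S.nonzero
    where
    ∣V₁-v∣<∣V₂∣ : size (remove side v) < size (not ∘ side)
    ∣V₁-v∣<∣V₂∣ = subst (size (remove side v) <_) (trans (sym (size-remove side sv)) ∣V₁∣≡∣V₂∣) (ℕₚ.n<1+n _)
    module S = NontrivialSolution (fewer-equations-than-unknowns _ (A G) (remove side v) (not ∘ side) refl ∣V₁-v∣<∣V₂∣)
    off-v : ∀ i → i ≢ v → u i ℚ.* mulA G S.x i ≡ 0ℚ
    off-v i i≢v with side i in si
    ... | true  = trans (cong (u i ℚ.*_) (S.solves i (trans (remove-other side i≢v) si))) (ℚₚ.*-zeroʳ (u i))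
    ... | false = trans (cong (ℚ._* mulA G S.x i) (u∈V₁ i si)) (ℚₚ.*-zeroˡ (mulA G S.x i))
    -- Row v was not imposed; ⟨u, A w⟩ = ⟨A u, w⟩ = 0 and only the term at v survives.
    at-v : mulA G S.x v ≡ 0ℚ
    at-v = *-cancelˡ-zero (u v) _ uv≢0
      (trans (sym (Σᶠ-single n _ v off-v)) (symmetric-kernel-orthogonal (A G) A-sym Au≡0 S.x))
    equations : ∀ i → not (side i) ≡ false → mulA G S.x i ≡ 0ℚ
    equations i nsi with i ≟ v
    ... | yes refl = at-v
    ... | no  i≢v  = S.solves i (trans (remove-other side i≢v) (not-injective nsi))
    Aw≡0 : InKer G S.x
    Aw≡0 = inKer-from-one-side (IsBipartition-not bip) S.supported equations

  sides-unbalanced : ∀ {side} → IsBipartition G side → NullityOne G → size side ≢ size (not ∘ side)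
  sides-unbalanced {side} bip η≡1@(b , Ab≡0 , (v , bv≢0) , _) ∣V₁∣≡∣V₂∣ with side v in sv
  ... | true  = balanced-sides-impossible bip η≡1 ∣V₁∣≡∣V₂∣
                  (restrict-inKer bip Ab≡0) (restrict-supported side b) (restrict-nonzero side b sv bv≢0) sv
  ... | false = balanced-sides-impossible (IsBipartition-not bip) η≡1
                  (trans (sym ∣V₁∣≡∣V₂∣) (sym (size-not-not side)))
                  (restrict-inKer (IsBipartition-not bip) Ab≡0) (restrict-supported (not ∘ side) b)
                  (restrict-nonzero (not ∘ side) b (cong not sv) bv≢0) (cong not sv)

  sides-differ-by-one : ∀ {side} → IsBipartition G side → NullityOne G →
                        size side ≡ suc (size (not ∘ side)) ⊎ size (not ∘ side) ≡ suc (size side)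
  sides-differ-by-one {side} bip η≡1 with ℕₚ.<-cmp (size side) (size (not ∘ side))
  ... | tri< ∣V₁∣<∣V₂∣ _ _ = inj₂ (trans
          (larger-side-exceeds-by-one (IsBipartition-not bip) η≡1 (subst (_< size (not ∘ side)) (sym (size-not-not side)) ∣V₁∣<∣V₂∣))
          (cong suc (size-not-not side)))
  ... | tri≈ _ ∣V₁∣≡∣V₂∣ _ = ⊥-elim (sides-unbalanced bip η≡1 ∣V₁∣≡∣V₂∣)
  ... | tri> _ _ ∣V₂∣<∣V₁∣ = inj₁ (larger-side-exceeds-by-one bip η≡1 ∣V₂∣<∣V₁∣)

suc[k+k]≡2k+1 : ∀ k → suc (k + k) ≡ 2 * k + 1
suc[k+k]≡2k+1 k = trans (cong (λ m → suc (k + m)) (sym (ℕₚ.+-identityʳ k))) (ℕₚ.+-comm 1 (2 * k))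

consecutive-sum-odd : ∀ {a b} → a ≡ suc b ⊎ b ≡ suc a → Σ ℕ λ k → a + b ≡ 2 * k + 1
consecutive-sum-odd {b = b} (inj₁ refl) = b , suc[k+k]≡2k+1 b
consecutive-sum-odd {a}     (inj₂ refl) = a , trans (ℕₚ.+-suc a a) (suc[k+k]≡2k+1 a)

[k+k]/2≡k : ∀ k → (k + k) / 2 ≡ k
[k+k]/2≡k k = trans (cong (_/ 2) (trans (cong (k +_) (sym (ℕₚ.+-identityʳ k))) (ℕₚ.*-comm 2 k))) (m*n/n≡m k 2)

mainTheorem9 : (n : ℕ) (G : Graph n) (side : Fin n → Bool) →
    IsBipartition G side → NullityOne G →
    (Σ ℕ λ k → n ≡ 2 * k + 1) ×
    (count n side true > count n side false →
      count n side false ≡ (n ∸ 1) / 2 ×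
      count n side true ≡ count n side false + 1) ×
    (count n side true > count n side false →
      ∀ v → Core G v → side v ≡ true)
mainTheorem9 n G side bip η≡1 = odd-order , larger-part-size , core-in-larger-side G bip η≡1 ∘ ∣V₂∣<∣V₁∣
  where
  ∣V₁∣+∣V₂∣≡n : size side + size (not ∘ side) ≡ n
  ∣V₁∣+∣V₂∣≡n = size+size-not n side
  ∣V₂∣ : count n side false ≡ size (not ∘ side)
  ∣V₂∣ = count-false≡size-not n side
  ∣V₂∣<∣V₁∣ : count n side true > count n side false → size (not ∘ side) < size side
  ∣V₂∣<∣V₁∣ = subst (_< size side) ∣V₂∣
  odd-order : Σ ℕ λ k → n ≡ 2 * k + 1
  odd-order = map₂ (trans (sym ∣V₁∣+∣V₂∣≡n)) (consecutive-sum-odd (sides-differ-by-one G bip η≡1))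
  larger-part-size : count n side true > count n side false →
                     count n side false ≡ (n ∸ 1) / 2 × count n side true ≡ count n side false + 1
  larger-part-size V₂<V₁ =
    trans ∣V₂∣ (sym (trans (cong (λ m → (m ∸ 1) / 2) n≡2∣V₂∣+1) ([k+k]/2≡k (size (not ∘ side))))) ,
    trans ∣V₁∣≡∣V₂∣+1 (trans (cong suc (sym ∣V₂∣)) (ℕₚ.+-comm 1 _))
    where
    ∣V₁∣≡∣V₂∣+1 = larger-side-exceeds-by-one G bip η≡1 (∣V₂∣<∣V₁∣ V₂<V₁)
    n≡2∣V₂∣+1 : n ≡ suc (size (not ∘ side) + size (not ∘ side))
    n≡2∣V₂∣+1 = trans (sym ∣V₁∣+∣V₂∣≡n) (cong (_+ size (not ∘ side)) ∣V₁∣≡∣V₂∣+1)
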